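{- Let $\mathcal{G}=\langle \mathit{Init},\mathit{Safe},\mathit{Reach},\mathit{Goal}\rangle$ be a reachability game and let $\sim$ be a bisimulation on $\mathcal{G}$ which is also an equivalence relation, with equivalence classes $S_1,\ldots,S_n$. Assume $S_1,\ldots,S_n$ are defined by $\psi_1,\ldots,\psi_n\in\mathcal{L}(\mathcal{V})$ (i.e., $\psi_i(s)$ holds iff $s\in S_i$). Let $\phi_1,\phi_2\in\mathcal{L}(\mathcal{V})$ each be equivalent to a disjunction of formulas $\psi_i$. Then $\operatorname{Pre}(\operatorname{Enf}(\phi_1\land\phi_2[\mathcal{V}/\mathcal{V}'],\mathcal{G}))$ is equivalent to a disjunction of formulas $\psi_i$.
   Context: Fix a logic $\mathcal{L}$ and a finite set of variables $\mathcal{V}$ with domains, primed copies $\mathcal{V}'$, and a Boolean variable $\mathbf{r}\in\mathcal{V}$; $\phi[\mathcal{V}/\mathcal{V}']$ replaces every variable of $\phi$ by its primed copy. A state is a valuation of $\mathcal{V}$ respecting domains; $S$ is the set of states; $\varphi(s)$, $\tau(s,s')$ denote evaluation of state predicates (formulas over $\mathcal{V}$) and transition predicates (over $\mathcal{V}\cup\mathcal{V}'$), with primed variables read from $s'$. A reachability game $\langle \mathit{Init},\mathit{Safe},\mathit{Reach},\mathit{Goal}\rangle$ has state predicates $\mathit{Init},\mathit{Goal}$ and transition predicates $\mathit{Safe},\mathit{Reach}$ with $\mathit{Safe}\Rightarrow\neg\mathbf{r}$ and $\mathit{Reach}\Rightarrow\mathbf{r}$ valid. A relation $B\subseteq S\times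 S$ is a bisimulation on $\mathcal{G}$ if for all $(s_1,s_2)\in B$: $\mathit{Goal}(s_1)\Leftrightarrow\mathit{Goal}(s_2)$, $\mathit{Init}(s_1)\Leftrightarrow\mathit{Init}(s_2)$, $\mathbf{r}(s_1)\Leftrightarrow\mathbf{r}(s_2)$; for every $s_1'$ with $(\mathit{Safe}\lor\mathit{Reach})(s_1,s_1')$ there is $s_2'$ with $(\mathit{Safe}\lor\mathit{Reach})(s_2,s_2')$ and $(s_1',s_2')\in B$; and for every $s_2'$ with $(\mathit{Safe}\lor\mathit{Reach})(s_2,s_2')$ there is $s_1'$ with $(\mathit{Safe}\lor\mathit{Reach})(s_1,s_1')$ and $(s_1',s_2')\in B$. $\operatorname{Pre}(T)=\exists\mathcal{V}'.T$ and $\operatorname{Enf}(T,\mathcal{G})=(\mathit{Safe}\lor\mathit{Reach})\land T\land\neg\exists\mathcal{V}'.(\mathit{Safe}\land\neg T)$. -}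

module Defs where

open import Data.Bool using (Bool; true; false)
open import Data.Fin using (Fin)
open import Data.Product using (Σ; _×_; _,_; ∃)
open import Data.Sum using (_⊎_)
open import Relation.Nullary using (¬_)
open import Relation.Binary.PropositionalEquality using (_≡_)
open import Relation.Binary using (Rel; IsEquivalence)
open import Function.Bundles using (_⇔_)

-- Semantic reading: a state predicate (formula over V) is a predicate on
-- states; a transition predicate (formula over V ∪ V') is a binary relation
-- on states, the primed variables being read from the second state.
StatePred : Set → Set₁
StatePred S = S → Set

TransPred : Set → Set₁
TransPred S = S → S → Set

record ReachGame (S : Set) (r : S → Bool) : Set₁ where
  field
    Init  : StatePred S
    Safe  : TransPred S
    Reach : TransPred S
    Goal  : StatePred S
    safe⇒¬r  : ∀ s s' → Safe s s' → r s ≡ false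
    reach⇒r  : ∀ s s' → Reach s s' → r s ≡ true

module _ {S : Set} {r : S → Bool} (G : ReachGame S r) where
  open ReachGame G

  Step : TransPred S
  Step s s' = Safe s s' ⊎ Reach s s'

  record IsBisimulation (B : Rel S _) : Set where
    field
      goal : ∀ {s₁ s₂} → B s₁ s₂ → Goal s₁ ⇔ Goal s₂
      init : ∀ {s₁ s₂} → B s₁ s₂ → Init s₁ ⇔ Init s₂
      rvar : ∀ {s₁ s₂} → B s₁ s₂ → r s₁ ≡ r s₂
      forth : ∀ {s₁ s₂} → B s₁ s₂ → ∀ s₁' → Step s₁ s₁' →
              Σ S λ s₂' → Step s₂ s₂' × B s₁' s₂'
      back  : ∀ {s₁ s₂} → B s₁ s₂ → ∀ s₂' → Step s₂ s₂' →
              Σ S λ s₁' → Step s₁ s₁' × B s₁' s₂'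

  Enf : TransPred S → TransPred S
  Enf T s s' = Step s s' × T s s' × ¬ (Σ S λ s'' → Safe s s'' × ¬ T s s'')

Pre : {S : Set} → TransPred S → StatePred S
Pre {S} T s = Σ S λ s' → T s s'

-- φ₁ ∧ φ₂[V/V'] : the transition predicate whose unprimed part is φ₁ and
-- whose primed part is φ₂.
_∧′_ : {S : Set} → StatePred S → StatePred S → TransPred S
(φ₁ ∧′ φ₂) s s' = φ₁ s × φ₂ s'

record DefinesClasses {S : Set} (_~_ : Rel S _) (n : _) (ψ : Fin n → StatePred S) : Set where
  field
    covers   : ∀ s → Σ (Fin n) λ i → ψ i s
    nonempty : ∀ i → Σ S λ s → ψ i s
    class    : ∀ i s t → ψ i s → (ψ i t ⇔ s ~ t)
    distinct : ∀ i j s → ψ i s → ψ j s → i ≡ j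

IsDisjOf : {S : Set} {n : _} → (Fin n → StatePred S) → StatePred S → Set₁
IsDisjOf {S} {n} ψ φ =
  Σ (Fin n → Set) λ I → ∀ s → φ s ⇔ (Σ (Fin n) λ i → I i × ψ i s)

-- A predicate that is a union of ~-classes is the same thing as a ~-invariant
-- predicate.  So it suffices that Pre (Enf G T) is invariant whenever T is
-- invariant on both sides.  Bisimilar states agree on r, and Safe and Reach
-- steps leave states with opposite values of r; hence a bisimulation matches
-- Safe steps by Safe steps, which is exactly what transfers the universally
-- quantified conjunct ¬ ∃V'. (Safe ∧ ¬ T) of Enf.
module Submission where

open import Defs
open import Data.Bool using (Bool; true; false)
open import Data.Nat using (ℕ)
open import Data.Fin using (Fin)
open import Data.Product using (Σ; _×_; _,_)
open import Data.Sum using (inj₁; inj₂)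
open import Level using (0ℓ)
open import Relation.Nullary using (¬_; contradiction)
open import Relation.Binary using (Rel; IsEquivalence; _Respects_; _Respects₂_)
open import Relation.Binary.PropositionalEquality using (_≡_; sym; module ≡-Reasoning)
open import Function using (_∘′_)
open import Function.Bundles using (mk⇔; Equivalence)

module _ {S : Set} {_~_ : Rel S 0ℓ} {n : ℕ} {ψ : Fin n → StatePred S}
         (classes : DefinesClasses _~_ n ψ) where
  open DefinesClasses classes

  IsDisjOf⇒respects : ∀ {φ} → IsDisjOf ψ φ → φ Respects _~_
  IsDisjOf⇒respects (I , φ⇔) {s} {t} s~t φs with Equivalence.to (φ⇔ s) φs
  ... | i , Ii , ψis = Equivalence.from (φ⇔ t) (i , Ii , Equivalence.from (class i s t ψis) s~t)

  respects⇒IsDisjOf : ∀ {φ} → φ Respects _~_ → IsDisjOf ψ φ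
  respects⇒IsDisjOf {φ} resp = I , λ s → mk⇔ (into s) (outof s)
    where
    I : Fin n → Set
    I i = Σ S λ t → ψ i t × φ t

    into : ∀ s → φ s → Σ (Fin n) λ i → I i × ψ i s
    into s φs with covers s
    ... | i , ψis = i , (s , ψis , φs) , ψis

    outof : ∀ s → (Σ (Fin n) λ i → I i × ψ i s) → φ s
    outof s (i , (t , ψit , φt) , ψis) = resp (Equivalence.to (class i t s ψit) ψis) φt

∧′-respects₂ : {S : Set} {_~_ : Rel S 0ℓ} {φ₁ φ₂ : StatePred S} →
               φ₁ Respects _~_ → φ₂ Respects _~_ → (φ₁ ∧′ φ₂) Respects₂ _~_
∧′-respects₂ resp₁ resp₂ = (λ { s'~t' (φ₁s , φ₂s') → φ₁s , resp₂ s'~t' φ₂s' })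
                         , (λ { s~t (φ₁s , φ₂s') → resp₁ s~t φ₁s , φ₂s' })

module _ {S : Set} {r : S → Bool} (G : ReachGame S r)
         {_≈_ : Rel S 0ℓ} (bisim : IsBisimulation G _≈_) where
  open ReachGame G
  open IsBisimulation bisim

  back-safe : ∀ {s₁ s₂} → s₁ ≈ s₂ → ∀ s₂' → Safe s₂ s₂' →
              Σ S λ s₁' → Safe s₁ s₁' × s₁' ≈ s₂'
  back-safe {s₁} {s₂} s₁≈s₂ s₂' safe₂ with back s₁≈s₂ s₂' (inj₁ safe₂)
  ... | s₁' , inj₁ safe₁ , s₁'≈s₂' = s₁' , safe₁ , s₁'≈s₂'
  ... | s₁' , inj₂ reach₁ , _ = contradiction true≡false λ ()
    where
    open ≡-Reasoning
    true≡false : true ≡ false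
    true≡false = begin
      true  ≡⟨ sym (reach⇒r s₁ s₁' reach₁) ⟩
      r s₁  ≡⟨ rvar s₁≈s₂ ⟩
      r s₂  ≡⟨ safe⇒¬r s₂ s₂' safe₂ ⟩
      false ∎

  Pre-Enf-respects : ∀ {T} → T Respects₂ _≈_ → Pre (Enf G T) Respects _≈_
  Pre-Enf-respects {T} (respʳ , respˡ) {s} {t} s≈t (s' , step , Tss' , noEscape)
    with forth s≈t s' step
  ... | t' , step' , s'≈t' = t' , step' , transfer s≈t s'≈t' Tss' , noEscape'
    where
    transfer : ∀ {a b a' b'} → a ≈ b → a' ≈ b' → T a a' → T b b'
    transfer a≈b a'≈b' = respˡ a≈b ∘′ respʳ a'≈b'

    noEscape' : ¬ (Σ S λ t'' → Safe t t'' × ¬ T t t'')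
    noEscape' (t'' , safe , ¬Ttt'') with back-safe s≈t t'' safe
    ... | s'' , safe' , s''≈t'' =
      noEscape (s'' , safe' , λ Tss'' → ¬Ttt'' (transfer s≈t s''≈t'' Tss''))

lemma9 : {S : Set} {r : S → Bool} (G : ReachGame S r)
         (_~_ : Rel S _) → IsBisimulation G _~_ → IsEquivalence _~_ →
         (n : ℕ) (ψ : Fin n → StatePred S) → DefinesClasses _~_ n ψ →
         (φ₁ φ₂ : StatePred S) → IsDisjOf ψ φ₁ → IsDisjOf ψ φ₂ →
         IsDisjOf ψ (Pre (Enf G (φ₁ ∧′ φ₂)))
lemma9 G _ bisim _ _ _ classes _ _ disj₁ disj₂ =
  respects⇒IsDisjOf classes
    (Pre-Enf-respects G bisim
      (∧′-respects₂ (IsDisjOf⇒respects classes disj₁) (IsDisjOf⇒respects classes disj₂)))
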